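{- For $p=011$: $\sum_{n\geq 0}|\mathcal{C}_n(p)|x^n=\frac{1-2x+2x^2}{(1-x)^3}$ and $|\mathcal{C}_n(p)|=1+\binom{n}{2}$ for all $n\geq 0$. Moreover, for all $n\geq 1$ the popularity of descents $\sum_{w\in\mathcal{C}_n(p)}d(w)$ equals $\frac{(n-1)(n-2)}{2}$, and $\sum_{n\geq 0}\big(\sum_{w\in\mathcal{C}_n(p)}d(w)\big)x^n=\frac{x^3}{(1-x)^3}$.
   Context: A Catalan word of length $n\geq 1$ is a word $w_1\ldots w_n$ over the non-negative integers with $w_1=0$ and $0\leq w_i\leq w_{i-1}+1$ for $2\leq i\leq n$; the empty word is the unique Catalan word of length $0$. A word $w$ contains the pattern $p=p_1\ldots p_k$ if there are indices $i_1<\cdots<i_k$ such that $w_{i_1}\ldots w_{i_k}$ is order-isomorphic to $p$ (for all $a,b$: $w_{i_a}<w_{i_b}$ iff $p_a<p_b$, and $w_{i_a}=w_{i_b}$ iff $p_a=p_b$); otherwise $w$ avoids $p$. $\mathcal{C}_n(p)$ is the set of Catalan words of length $n$ avoiding $p$. A descent of $w$ is an index $i$ with $w_i>w_{i+1}$; $d(w)$ denotes the number of descents of $w$. -}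

module Defs where

open import Data.Nat using (ℕ; zero; suc; _+_; _<ᵇ_; _≡ᵇ_; _≤ᵇ_)
open import Data.Bool using (Bool; true; false; _∧_; if_then_else_; not)
open import Data.List using (List; []; _∷_; map; concatMap; filter; length; upTo; zip)
open import Data.Bool.ListAction using (all; any)
open import Relation.Binary.PropositionalEquality using (_≡_)
open import Data.Product using (_×_; _,_)
open import Data.Integer as ℤ using (ℤ)
open import Relation.Nullary.Decidable using (Dec)
open import Data.Bool.Properties using (T?)

Word : Set
Word = List ℕ

_==_ : Bool → Bool → Bool
true  == b = b
false == b = not b

catalanFrom : ℕ → Word → Bool
catalanFrom prev []      = true
catalanFrom prev (y ∷ r) = (y ≤ᵇ suc prev) ∧ catalanFrom y r

isCatalan : Word → Bool
isCatalan []      = true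
isCatalan (x ∷ r) = (x ≡ᵇ 0) ∧ catalanFrom x r

wordsOver : ℕ → ℕ → List Word
wordsOver k zero    = [] ∷ []
wordsOver k (suc n) = concatMap (λ a → map (a ∷_) (wordsOver k n)) (upTo k)

subseqs : Word → List Word
subseqs []      = [] ∷ []
subseqs (x ∷ r) = let s = subseqs r in s Data.List.++ map (x ∷_) s

orderIso : Word → Word → Bool
orderIso u p =
  (length u ≡ᵇ length p) ∧
  all (λ { (a , x) → all (λ { (b , y) →
        ((a <ᵇ b) == (x <ᵇ y)) ∧ ((a ≡ᵇ b) == (x ≡ᵇ y)) }) zs }) zs
  where zs = zip u p

contains : Word → Word → Bool
contains w p = any (λ s → orderIso s p) (subseqs w)

avoids : Word → Word → Bool
avoids w p = not (contains w p)

-- 𝒞ₙ(p): Catalan words of length n avoiding p.  Every Catalan word of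
-- length n has all letters ≤ n - 1 < n, so filtering the words over
-- {0,…,n-1} of length n lists each Catalan word of length n exactly once.
Cat : ℕ → Word → List Word
Cat n p = filter (λ w → T? (isCatalan w ∧ avoids w p)) (wordsOver n n)

des : Word → ℕ
des (x ∷ y ∷ r) = (if y <ᵇ x then 1 else 0) + des (y ∷ r)
des _           = 0

Series : Set
Series = ℕ → ℤ

convo : Series → Series → ℕ → ℕ → ℤ
convo f g n zero    = f 0 ℤ.* g n
convo f g n (suc i) = f (suc i) ℤ.* g (n Data.Nat.∸ suc i) ℤ.+ convo f g n i

_⊛_ : Series → Series → Series
(f ⊛ g) n = convo f g n n

poly : List ℤ → Series
poly []       n       = ℤ.0ℤ
poly (c ∷ cs) zero    = c
poly (c ∷ cs) (suc n) = poly cs n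

_^ˢ_ : Series → ℕ → Series
f ^ˢ zero  = poly (ℤ.1ℤ ∷ [])
f ^ˢ suc k = f ⊛ (f ^ˢ k)

oneMinusX : Series
oneMinusX = poly (ℤ.1ℤ ∷ ℤ.-1ℤ ∷ [])

-- "Σ aₙ xⁿ = N(x) / D(x)" as an identity of formal power series D · A = N
-- (D has constant term 1, hence is invertible).
HasGF : (ℕ → ℕ) → Series → Series → Set
HasGF a N D = ∀ n → (D ⊛ (λ k → ℤ.+ a k)) n ≡ N n

-- A Catalan word 0 ∷ r contains 011 exactly when some positive letter occurs
-- twice.  Reading such a word letter by letter, the only states are "climbing
-- 0ᵃ 1 2 … m" and "fallen back to 0 after the peak m ≥ 1", and from the second
-- state only zeros may follow.  So the words are 0ⁿ and 0ᵃ 1 2 … m 0ᵇ with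
-- a, m ≥ 1: there are 1 + C(n,2) of them, and those with b ≥ 1 carry exactly
-- one descent, giving C(n-1,2).  Both sequences are quadratic in n, so their
-- third differences vanish, which is the generating-function identity with
-- denominator (1 - x)³.
module Submission where

open import Defs
open import Data.Nat
  using (ℕ; zero; suc; _+_; _*_; _∸_; _/_; _<ᵇ_; _≡ᵇ_; _≤_; _<_; z≤n; s≤s; _<?_)
open import Data.Nat.Properties
  using (+-comm; +-identityʳ; +-suc; ≤-refl; n≤1+n; ≤-trans; m≤n+m; m≤m+n; *-comm; *-identityʳ;
         suc-injective; +-monoʳ-≤; m+n≤o⇒m≤o∸n; ≮⇒≥; <-cmp; module ≤-Reasoning)
open import Data.Nat.Combinatorics using (_C_; nCk+nC[k+1]≡[n+1]C[k+1]; nC1≡n; nCk≡nPk/k!)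
open import Data.Bool using (Bool; true; false; _∧_; _∨_; not; if_then_else_; T)
open import Data.Bool.Properties
  using (T?; ∧-zeroʳ; ∨-assoc; ∨-comm; ∧-distribˡ-∨; ∨-identityʳ; T-∨; T-∧)
open import Data.Bool.ListAction using (any; all; or)
open import Data.List using (List; []; _∷_; map; _++_; length; filter; concatMap; replicate; applyUpTo; upTo)
open import Data.List.Properties using (map-++; map-∘; map-cong; map-upTo)
open import Data.Nat.ListAction using (sum)
open import Data.Nat.ListAction.Properties using (sum-++)
open import Data.Integer as ℤ using (ℤ; 0ℤ; -[1+_]; _-_)
open import Data.Integer.Properties using (*-zeroˡ; *-zeroʳ; +-identityˡ)
open import Data.Integer.Tactic.RingSolver using (solve-∀)
open import Data.Product using (_×_; _,_; proj₂)
open import Data.Sum using (inj₁; inj₂)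
open import Data.Empty using (⊥-elim)
open import Function using (_∘_; Equivalence)
open import Relation.Nullary using (yes; no)
open import Relation.Binary.Definitions using (tri<; tri≈; tri>)
open import Relation.Binary.PropositionalEquality
  using (_≡_; _≢_; refl; sym; trans; cong; cong₂; subst; module ≡-Reasoning)

open Equivalence

p011 : Word
p011 = 0 ∷ 1 ∷ 1 ∷ []

<ᵇ-true : ∀ {m n} → m < n → (m <ᵇ n) ≡ true
<ᵇ-true (s≤s z≤n)       = refl
<ᵇ-true (s≤s (s≤s m<n)) = <ᵇ-true (s≤s m<n)

<ᵇ-false : ∀ {m n} → n ≤ m → (m <ᵇ n) ≡ false
<ᵇ-false z≤n       = refl
<ᵇ-false (s≤s n≤m) = <ᵇ-false n≤m

≡ᵇ-refl : ∀ n → (n ≡ᵇ n) ≡ true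
≡ᵇ-refl zero    = refl
≡ᵇ-refl (suc n) = ≡ᵇ-refl n

-- Raising all three letters by one changes no comparison, so the last clause is
-- definitional and only triples containing a 0 need work.
orderIso-011 : ∀ x y z → orderIso (x ∷ y ∷ z ∷ []) p011 ≡ (x <ᵇ y) ∧ (y ≡ᵇ z)
orderIso-011 zero    zero    z       = refl
orderIso-011 zero    (suc y) zero    = refl
orderIso-011 zero    (suc y) (suc z) = from0 y z
  where
  from0 : ∀ y z → orderIso (0 ∷ suc y ∷ suc z ∷ []) p011 ≡ (y ≡ᵇ z)
  from0 zero    zero    = refl
  from0 zero    (suc z) = refl
  from0 (suc y) zero    rewrite <ᵇ-false (≤-refl {y}) | ≡ᵇ-refl y = refl
  from0 (suc y) (suc z) = from0 y z
orderIso-011 (suc x) zero    z       rewrite <ᵇ-false (≤-refl {x}) | ≡ᵇ-refl x = refl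
orderIso-011 (suc x) (suc y) zero    rewrite <ᵇ-false (≤-refl {x}) | ≡ᵇ-refl x
  with x <ᵇ y | x ≡ᵇ y
... | false | _     = refl
... | true  | false = refl
... | true  | true  = refl
orderIso-011 (suc x) (suc y) (suc z) = orderIso-011 x y z

any-++ : ∀ {A : Set} (g : A → Bool) xs ys → any g (xs ++ ys) ≡ any g xs ∨ any g ys
any-++ g []       ys = refl
any-++ g (x ∷ xs) ys = trans (cong (g x ∨_) (any-++ g xs ys)) (sym (∨-assoc (g x) _ _))

any-map : ∀ {A B : Set} (g : B → Bool) (f : A → B) xs → any g (map f xs) ≡ any (g ∘ f) xs
any-map g f xs = cong or (sym (map-∘ xs))

any-subseqs-∷ : ∀ (g : Word → Bool) x r →
  any g (subseqs (x ∷ r)) ≡ any g (subseqs r) ∨ any (g ∘ (x ∷_)) (subseqs r)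
any-subseqs-∷ g x r =
  trans (any-++ g (subseqs r) _) (cong (any g (subseqs r) ∨_) (any-map g (x ∷_) (subseqs r)))

-- [] is always a subsequence, and the only one g can accept.
any-subseqs-[] : ∀ (g : Word → Bool) r → (∀ a s → g (a ∷ s) ≡ false) → any g (subseqs r) ≡ g []
any-subseqs-[] g []      _   = ∨-identityʳ (g [])
any-subseqs-[] g (x ∷ r) g∷ = begin
  any g (subseqs (x ∷ r))                           ≡⟨ any-subseqs-∷ g x r ⟩
  any g (subseqs r) ∨ any (g ∘ (x ∷_)) (subseqs r)  ≡⟨ cong₂ _∨_ (any-subseqs-[] g r g∷) (none (subseqs r)) ⟩
  g [] ∨ false                                      ≡⟨ ∨-identityʳ (g []) ⟩
  g []                                              ∎
  where
  open ≡-Reasoning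
  none : ∀ ss → any (g ∘ (x ∷_)) ss ≡ false
  none []       = refl
  none (s ∷ ss) rewrite g∷ x s = none ss

occurs : ℕ → Word → Bool
occurs y = any (y ≡ᵇ_)

repeatsAbove : ℕ → Word → Bool
repeatsAbove x []      = false
repeatsAbove x (y ∷ r) = ((x <ᵇ y) ∧ occurs y r) ∨ repeatsAbove x r

any-011-from₂ : ∀ x y r → any (λ s → orderIso (x ∷ y ∷ s) p011) (subseqs r) ≡ (x <ᵇ y) ∧ occurs y r
any-011-from₂ x y []      = sym (∧-zeroʳ (x <ᵇ y))
any-011-from₂ x y (z ∷ r) = begin
  any (λ s → orderIso (x ∷ y ∷ s) p011) (subseqs (z ∷ r))
    ≡⟨ any-subseqs-∷ _ z r ⟩
  any (λ s → orderIso (x ∷ y ∷ s) p011) (subseqs r)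
    ∨ any (λ s → orderIso (x ∷ y ∷ z ∷ s) p011) (subseqs r)
    ≡⟨ cong₂ _∨_ (any-011-from₂ x y r) (any-subseqs-[] _ r (λ _ _ → refl)) ⟩
  ((x <ᵇ y) ∧ occurs y r) ∨ orderIso (x ∷ y ∷ z ∷ []) p011
    ≡⟨ cong (((x <ᵇ y) ∧ occurs y r) ∨_) (orderIso-011 x y z) ⟩
  ((x <ᵇ y) ∧ occurs y r) ∨ ((x <ᵇ y) ∧ (y ≡ᵇ z))
    ≡⟨ ∨-comm ((x <ᵇ y) ∧ occurs y r) ((x <ᵇ y) ∧ (y ≡ᵇ z)) ⟩
  ((x <ᵇ y) ∧ (y ≡ᵇ z)) ∨ ((x <ᵇ y) ∧ occurs y r)
    ≡⟨ sym (∧-distribˡ-∨ (x <ᵇ y) (y ≡ᵇ z) (occurs y r)) ⟩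
  (x <ᵇ y) ∧ occurs y (z ∷ r)
    ∎
  where open ≡-Reasoning

any-011-from₁ : ∀ x r → any (λ s → orderIso (x ∷ s) p011) (subseqs r) ≡ repeatsAbove x r
any-011-from₁ x []      = refl
any-011-from₁ x (y ∷ r) =
  trans (any-subseqs-∷ _ y r)
        (trans (cong₂ _∨_ (any-011-from₁ x r) (any-011-from₂ x y r)) (∨-comm (repeatsAbove x r) _))

contains-011-∷ : ∀ x r → contains (x ∷ r) p011 ≡ contains r p011 ∨ repeatsAbove x r
contains-011-∷ x r = trans (any-subseqs-∷ _ x r) (cong (contains r p011 ∨_) (any-011-from₁ x r))

repeatsAbove-∷ : ∀ x y r → T (repeatsAbove x r) → T (repeatsAbove x (y ∷ r))
repeatsAbove-∷ x y r t = T-∨ {(x <ᵇ y) ∧ occurs y r} .from (inj₂ t)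

repeatsAbove⇒repeatsAbove0 : ∀ x r → T (repeatsAbove x r) → T (repeatsAbove 0 r)
repeatsAbove⇒repeatsAbove0 x (zero ∷ r)  t = repeatsAbove⇒repeatsAbove0 x r t
repeatsAbove⇒repeatsAbove0 x (suc y ∷ r) t with T-∨ .to t
... | inj₂ t′ = repeatsAbove-∷ 0 (suc y) r (repeatsAbove⇒repeatsAbove0 x r t′)
... | inj₁ t′ = T-∨ .from (inj₁ (proj₂ (T-∧ {x <ᵇ suc y} .to t′)))

contains011⇒repeatsAbove0 : ∀ r → T (contains r p011) → T (repeatsAbove 0 r)
contains011⇒repeatsAbove0 (x ∷ r) t with T-∨ .to (subst T (contains-011-∷ x r) t)
... | inj₁ t′ = repeatsAbove-∷ 0 x r (contains011⇒repeatsAbove0 r t′)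
... | inj₂ t′ = repeatsAbove-∷ 0 x r (repeatsAbove⇒repeatsAbove0 x r t′)

∨-absorbed : ∀ {a b} → (T a → T b) → a ∨ b ≡ b
∨-absorbed {false}         _    = refl
∨-absorbed {true}  {true}  _    = refl
∨-absorbed {true}  {false} a⇒b = ⊥-elim (a⇒b _)

contains-011-0∷ : ∀ r → contains (0 ∷ r) p011 ≡ repeatsAbove 0 r
contains-011-0∷ r = trans (contains-011-∷ 0 r) (∨-absorbed (contains011⇒repeatsAbove0 r))

fresh : ℕ → ℕ → Bool
fresh m z = (z ≡ᵇ 0) ∨ (m <ᵇ z)

freshAbove : ℕ → Word → Bool
freshAbove m = all (fresh m)

fresh-suc : ∀ m z → fresh (suc m) z ≡ not (suc m ≡ᵇ z) ∧ fresh m z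
fresh-suc m zero = refl
fresh-suc m (suc z) = go m z
  where
  go : ∀ m z → (m <ᵇ z) ≡ not (m ≡ᵇ z) ∧ (m <ᵇ suc z)
  go zero    zero    = refl
  go zero    (suc z) = refl
  go (suc m) zero    = refl
  go (suc m) (suc z) = go m z

freshAbove-0 : ∀ r → freshAbove 0 r ≡ true
freshAbove-0 []          = refl
freshAbove-0 (zero ∷ r)  = freshAbove-0 r
freshAbove-0 (suc z ∷ r) = freshAbove-0 r

freshAbove-suc : ∀ m r → freshAbove (suc m) r ≡ not (occurs (suc m) r) ∧ freshAbove m r
freshAbove-suc m []      = refl
freshAbove-suc m (z ∷ r) rewrite fresh-suc m z | freshAbove-suc m r = interchange (suc m ≡ᵇ z) _ _ _
  where
  interchange : ∀ a b c d → (not a ∧ c) ∧ (not b ∧ d) ≡ not (a ∨ b) ∧ (c ∧ d)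
  interchange true  b c     d = refl
  interchange false b true  d = refl
  interchange false b false d = sym (∧-zeroʳ (not b))

-- r continues a prefix that ends in the letter p and whose positive letters are
-- exactly 1, …, m, each used once, to a Catalan word avoiding 011.  Only the
-- states p = m (at the peak) and p = 0 < m (dropped after the peak) occur.
good : ℕ → ℕ → Word → Bool
good m p r = catalanFrom p r ∧ (freshAbove m r ∧ not (repeatsAbove 0 r))

inCat011 : Word → Bool
inCat011 w = isCatalan w ∧ avoids w p011

inCat011-0∷ : ∀ r → inCat011 (0 ∷ r) ≡ good 0 0 r
inCat011-0∷ r rewrite contains-011-0∷ r | freshAbove-0 r = refl

good-climb : ∀ m r → good m m (suc m ∷ r) ≡ good (suc m) (suc m) r
good-climb m r rewrite <ᵇ-true (≤-refl {suc m}) | freshAbove-suc m r =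
  cong (catalanFrom (suc m) r ∧_) (rearrange (occurs (suc m) r))
  where
  rearrange : ∀ o → freshAbove m r ∧ not (o ∨ repeatsAbove 0 r)
                  ≡ (not o ∧ freshAbove m r) ∧ not (repeatsAbove 0 r)
  rearrange true  = ∧-zeroʳ (freshAbove m r)
  rearrange false = refl

good-jump : ∀ m a r → a ≢ m → good m m (suc a ∷ r) ≡ false
good-jump m a r a≢m with <-cmp a m
... | tri< a<m _ _ rewrite <ᵇ-false {m} {suc a} a<m = ∧-zeroʳ (catalanFrom m (suc a ∷ r))
... | tri≈ _ a≡m _ = ⊥-elim (a≢m a≡m)
... | tri> _ _ m<a rewrite <ᵇ-false {a} {suc m} m<a = refl

good-rise-after-drop : ∀ m a r → good (suc m) 0 (suc a ∷ r) ≡ false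
good-rise-after-drop m zero    r = ∧-zeroʳ (catalanFrom 1 r)
good-rise-after-drop m (suc a) r = refl

sumWhere : (Word → Bool) → (Word → ℕ) → List Word → ℕ
sumWhere P φ ws = sum (map (λ w → if P w then φ w else 0) ws)

sum-map-filter : ∀ (P : Word → Bool) (φ : Word → ℕ) ws →
  sum (map φ (filter (λ w → T? (P w)) ws)) ≡ sumWhere P φ ws
sum-map-filter P φ []       = refl
sum-map-filter P φ (w ∷ ws) with P w
... | true  = cong (φ w +_) (sum-map-filter P φ ws)
... | false = sum-map-filter P φ ws

length≡sum-map-1 : ∀ {A : Set} (xs : List A) → length xs ≡ sum (map (λ _ → 1) xs)
length≡sum-map-1 []       = refl
length≡sum-map-1 (x ∷ xs) = cong suc (length≡sum-map-1 xs)

sumWhere-cong : ∀ {P Q : Word → Bool} {φ ψ : Word → ℕ} →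
  (∀ w → P w ≡ Q w) → (∀ w → φ w ≡ ψ w) → ∀ ws → sumWhere P φ ws ≡ sumWhere Q ψ ws
sumWhere-cong P≗Q φ≗ψ ws =
  cong sum (map-cong (λ w → cong₂ (λ b x → if b then x else 0) (P≗Q w) (φ≗ψ w)) ws)

sumWhere-none : ∀ {P : Word → Bool} (φ : Word → ℕ) → (∀ w → P w ≡ false) →
  ∀ ws → sumWhere P φ ws ≡ 0
sumWhere-none φ P≡false []       = refl
sumWhere-none φ P≡false (w ∷ ws) rewrite P≡false w = sumWhere-none φ P≡false ws

sum-map-concatMap : ∀ {A B : Set} (φ : B → ℕ) (f : A → List B) xs →
  sum (map φ (concatMap f xs)) ≡ sum (map (λ x → sum (map φ (f x))) xs)
sum-map-concatMap φ f []       = refl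
sum-map-concatMap φ f (x ∷ xs) = begin
  sum (map φ (f x ++ concatMap f xs))               ≡⟨ cong sum (map-++ φ (f x) _) ⟩
  sum (map φ (f x) ++ map φ (concatMap f xs))       ≡⟨ sum-++ (map φ (f x)) _ ⟩
  sum (map φ (f x)) + sum (map φ (concatMap f xs))  ≡⟨ cong (_ +_) (sum-map-concatMap φ f xs) ⟩
  sum (map φ (f x)) + sum (map (λ x → sum (map φ (f x))) xs) ∎
  where open ≡-Reasoning

sum-map-wordsOver-suc : ∀ (φ : Word → ℕ) k n →
  sum (map φ (wordsOver k (suc n))) ≡ sum (applyUpTo (λ a → sum (map (φ ∘ (a ∷_)) (wordsOver k n))) k)
sum-map-wordsOver-suc φ k n = begin
  sum (map φ (concatMap (λ a → map (a ∷_) (wordsOver k n)) (upTo k)))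
    ≡⟨ sum-map-concatMap φ _ (upTo k) ⟩
  sum (map (λ a → sum (map φ (map (a ∷_) (wordsOver k n)))) (upTo k))
    ≡⟨ cong sum (map-cong (λ a → cong sum (sym (map-∘ (wordsOver k n)))) (upTo k)) ⟩
  sum (map (λ a → sum (map (φ ∘ (a ∷_)) (wordsOver k n))) (upTo k))
    ≡⟨ cong sum (map-upTo _ k) ⟩
  sum (applyUpTo (λ a → sum (map (φ ∘ (a ∷_)) (wordsOver k n))) k)
    ∎
  where open ≡-Reasoning

sum-applyUpTo-zero : ∀ (F : ℕ → ℕ) k → (∀ i → F i ≡ 0) → sum (applyUpTo F k) ≡ 0
sum-applyUpTo-zero F zero    F≡0 = refl
sum-applyUpTo-zero F (suc k) F≡0 rewrite F≡0 0 = sum-applyUpTo-zero (F ∘ suc) k (F≡0 ∘ suc)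

sum-applyUpTo-head : ∀ (F : ℕ → ℕ) k → (∀ i → F (suc i) ≡ 0) → sum (applyUpTo F (suc k)) ≡ F 0
sum-applyUpTo-head F k F∘suc≡0 =
  trans (cong (F 0 +_) (sum-applyUpTo-zero (F ∘ suc) k F∘suc≡0)) (+-identityʳ (F 0))

sum-applyUpTo-single : ∀ (F : ℕ → ℕ) {m k} → m < k → (∀ i → i ≢ m → F i ≡ 0) →
  sum (applyUpTo F k) ≡ F m
sum-applyUpTo-single F {zero}  {suc k} _         F≡0 = sum-applyUpTo-head F k (λ i → F≡0 (suc i) λ ())
sum-applyUpTo-single F {suc m} {suc k} (s≤s m<k) F≡0 rewrite F≡0 0 (λ ()) =
  sum-applyUpTo-single (F ∘ suc) m<k (λ i i≢m → F≡0 (suc i) (i≢m ∘ suc-injective))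

sumWhere-wordsOver-suc : ∀ (P : Word → Bool) (φ : Word → ℕ) k n →
  sumWhere P φ (wordsOver k (suc n))
    ≡ sum (applyUpTo (λ a → sumWhere (P ∘ (a ∷_)) (φ ∘ (a ∷_)) (wordsOver k n)) k)
sumWhere-wordsOver-suc P φ = sum-map-wordsOver-suc (λ w → if P w then φ w else 0)

goodSum : (k m p n : ℕ) → (Word → ℕ) → ℕ
goodSum k m p n φ = sumWhere (good m p) φ (wordsOver k n)

goodSum-cong : ∀ k m p n {φ ψ : Word → ℕ} → (∀ r → φ r ≡ ψ r) →
  goodSum k m p n φ ≡ goodSum k m p n ψ
goodSum-cong k m p n φ≗ψ = sumWhere-cong (λ _ → refl) φ≗ψ (wordsOver k n)

goodSum-peak : ∀ {k m} n (φ : Word → ℕ) → m < k →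
  goodSum (suc k) m m (suc n) φ
    ≡ goodSum (suc k) m 0 n (φ ∘ (0 ∷_)) + goodSum (suc k) (suc m) (suc m) n (φ ∘ (suc m ∷_))
goodSum-peak {k} {m} n φ m<k =
  trans (sumWhere-wordsOver-suc (good m m) φ (suc k) n) (cong (goodSum (suc k) m 0 n (φ ∘ (0 ∷_)) +_) jumps)
  where
  W : List Word
  W = wordsOver (suc k) n
  F : ℕ → ℕ
  F a = sumWhere (λ r → good m m (a ∷ r)) (φ ∘ (a ∷_)) W
  jumps : sum (applyUpTo (F ∘ suc) k) ≡ goodSum (suc k) (suc m) (suc m) n (φ ∘ (suc m ∷_))
  jumps = trans (sum-applyUpTo-single (F ∘ suc) m<k
                   (λ a a≢m → sumWhere-none _ (λ r → good-jump m a r a≢m) W))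
                (sumWhere-cong (good-climb m) (λ _ → refl) W)

goodSum-dropped : ∀ {k m} n (φ : Word → ℕ) → goodSum (suc k) (suc m) 0 n φ ≡ φ (replicate n 0)
goodSum-dropped {k} {m} zero    φ = +-identityʳ (φ [])
goodSum-dropped {k} {m} (suc n) φ =
  trans (sumWhere-wordsOver-suc (good (suc m) 0) φ (suc k) n)
        (trans (sum-applyUpTo-head F k (λ a → sumWhere-none _ (good-rise-after-drop m a) W))
               (goodSum-dropped n (φ ∘ (0 ∷_))))
  where
  W : List Word
  W = wordsOver (suc k) n
  F : ℕ → ℕ
  F a = sumWhere (λ r → good (suc m) 0 (a ∷ r)) (φ ∘ (a ∷_)) W

des-zeros : ∀ n → des (replicate n 0) ≡ 0
des-zeros zero          = refl
des-zeros (suc zero)    = refl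
des-zeros (suc (suc n)) = des-zeros (suc n)

C2-suc : ∀ n → suc n C 2 ≡ n + n C 2
C2-suc n = trans (sym (nCk+nC[k+1]≡[n+1]C[k+1] n 1)) (cong (_+ n C 2) (nC1≡n n))

-- The ascent m + 1, m + 2, … must stay inside the alphabet {0, …, k}.
module _ {k m n : ℕ} (bound : suc m + suc n ≤ k) where

  climbing-bound : suc (suc m) + n ≤ k
  climbing-bound = subst (_≤ k) (+-suc (suc m) n) bound

  climbing-peak : suc m < k
  climbing-peak = ≤-trans (s≤s (s≤s (m≤m+n m n))) climbing-bound

goodSum-climbing-count : ∀ {k} m n → suc m + n ≤ k → goodSum (suc k) (suc m) (suc m) n (λ _ → 1) ≡ suc n
goodSum-climbing-count m zero    _     = refl
goodSum-climbing-count m (suc n) bound =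
  trans (goodSum-peak n (λ _ → 1) (climbing-peak bound))
        (cong₂ _+_ (goodSum-dropped n (λ _ → 1)) (goodSum-climbing-count (suc m) n (climbing-bound bound)))

goodSum-climbing-des : ∀ {k} m n → suc m + n ≤ k →
  goodSum (suc k) (suc m) (suc m) n (λ r → des (suc m ∷ r)) ≡ n
goodSum-climbing-des m zero    _     = refl
goodSum-climbing-des {k} m (suc n) bound =
  trans (goodSum-peak n (λ r → des (suc m ∷ r)) (climbing-peak bound))
        (cong₂ _+_ (trans (goodSum-dropped n _) (cong suc (des-zeros (suc n))))
                   (trans (goodSum-cong (suc k) (suc (suc m)) (suc (suc m)) n ascent)
                          (goodSum-climbing-des (suc m) n (climbing-bound bound))))
  where
  ascent : ∀ r → des (suc m ∷ suc (suc m) ∷ r) ≡ des (suc (suc m) ∷ r)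
  ascent r = cong (λ b → (if b then 1 else 0) + des (suc (suc m) ∷ r)) (<ᵇ-false (n≤1+n m))

goodSum-start-count : ∀ {k} n → n ≤ k → goodSum (suc k) 0 0 n (λ _ → 1) ≡ 1 + suc n C 2
goodSum-start-count zero    _   = refl
goodSum-start-count {k} (suc n) n<k = begin
  goodSum (suc k) 0 0 (suc n) (λ _ → 1)
    ≡⟨ goodSum-peak n (λ _ → 1) (≤-trans (s≤s z≤n) n<k) ⟩
  goodSum (suc k) 0 0 n (λ _ → 1) + goodSum (suc k) 1 1 n (λ _ → 1)
    ≡⟨ cong₂ _+_ (goodSum-start-count n (≤-trans (n≤1+n n) n<k)) (goodSum-climbing-count 0 n n<k) ⟩
  1 + suc n C 2 + suc n
    ≡⟨ cong suc (+-comm (suc n C 2) (suc n)) ⟩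
  1 + (suc n + suc n C 2)
    ≡⟨ cong suc (C2-suc (suc n)) ⟨
  1 + suc (suc n) C 2
    ∎
  where open ≡-Reasoning

goodSum-start-des : ∀ {k} n → n ≤ k → goodSum (suc k) 0 0 n (λ r → des (0 ∷ r)) ≡ n C 2
goodSum-start-des zero    _   = refl
goodSum-start-des {k} (suc n) n<k = begin
  goodSum (suc k) 0 0 (suc n) (λ r → des (0 ∷ r))
    ≡⟨ goodSum-peak n _ (≤-trans (s≤s z≤n) n<k) ⟩
  goodSum (suc k) 0 0 n (λ r → des (0 ∷ r)) + goodSum (suc k) 1 1 n (λ r → des (1 ∷ r))
    ≡⟨ cong₂ _+_ (goodSum-start-des n (≤-trans (n≤1+n n) n<k)) (goodSum-climbing-des 0 n n<k) ⟩
  n C 2 + n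
    ≡⟨ +-comm (n C 2) n ⟩
  n + n C 2
    ≡⟨ C2-suc n ⟨
  suc n C 2
    ∎
  where open ≡-Reasoning

sum-map-Cat011 : ∀ (φ : Word → ℕ) n →
  sum (map φ (Cat (suc n) p011)) ≡ goodSum (suc n) 0 0 n (φ ∘ (0 ∷_))
sum-map-Cat011 φ n = begin
  sum (map φ (Cat (suc n) p011))
    ≡⟨ sum-map-filter inCat011 φ (wordsOver (suc n) (suc n)) ⟩
  sumWhere inCat011 φ (wordsOver (suc n) (suc n))
    ≡⟨ sumWhere-wordsOver-suc inCat011 φ (suc n) n ⟩
  sum (applyUpTo F (suc n))
    ≡⟨ sum-applyUpTo-head F n (λ a → sumWhere-none (φ ∘ (suc a ∷_)) (λ _ → refl) W) ⟩
  F 0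
    ≡⟨ sumWhere-cong inCat011-0∷ (λ _ → refl) W ⟩
  goodSum (suc n) 0 0 n (φ ∘ (0 ∷_))
    ∎
  where
  open ≡-Reasoning
  W : List Word
  W = wordsOver (suc n) n
  F : ℕ → ℕ
  F a = sumWhere (inCat011 ∘ (a ∷_)) (φ ∘ (a ∷_)) W

length-Cat011 : ∀ n → length (Cat n p011) ≡ 1 + n C 2
length-Cat011 zero    = refl
length-Cat011 (suc n) =
  trans (length≡sum-map-1 (Cat (suc n) p011))
        (trans (sum-map-Cat011 (λ _ → 1) n) (goodSum-start-count n ≤-refl))

des-Cat011 : ∀ n → sum (map des (Cat (suc n) p011)) ≡ n C 2
des-Cat011 n = trans (sum-map-Cat011 des n) (goodSum-start-des n ≤-refl)

DegreeAtMost : Series → ℕ → Set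
DegreeAtMost f d = ∀ i → d < i → f i ≡ 0ℤ

⊛-degree : ∀ {f g df dg} → DegreeAtMost f df → DegreeAtMost g dg → DegreeAtMost (f ⊛ g) (df + dg)
⊛-degree {f} {g} {df} {dg} f-deg g-deg n d<n = convo≡0 n
  where
  term≡0 : ∀ i → f i ℤ.* g (n ∸ i) ≡ 0ℤ
  term≡0 i with df <? i
  ... | yes df<i = trans (cong (ℤ._* g (n ∸ i)) (f-deg i df<i)) (*-zeroˡ (g (n ∸ i)))
  ... | no  df≮i = trans (cong (f i ℤ.*_) (g-deg (n ∸ i) dg<n∸i)) (*-zeroʳ (f i))
    where
    open ≤-Reasoning
    dg<n∸i : dg < n ∸ i
    dg<n∸i = m+n≤o⇒m≤o∸n (suc dg) (begin
      suc dg + i    ≤⟨ +-monoʳ-≤ (suc dg) (≮⇒≥ df≮i) ⟩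
      suc dg + df   ≡⟨ cong suc (+-comm dg df) ⟩
      suc (df + dg) ≤⟨ d<n ⟩
      n             ∎)
  convo≡0 : ∀ i → convo f g n i ≡ 0ℤ
  convo≡0 zero    = term≡0 0
  convo≡0 (suc i) = cong₂ ℤ._+_ (term≡0 (suc i)) (convo≡0 i)

^ˢ-degree : ∀ {f d} → DegreeAtMost f d → ∀ k → DegreeAtMost (f ^ˢ k) (k * d)
^ˢ-degree f-deg zero    (suc i) _ = refl
^ˢ-degree f-deg (suc k)         = ⊛-degree f-deg (^ˢ-degree f-deg k)

oneMinusX-degree : DegreeAtMost oneMinusX 1
oneMinusX-degree (suc zero)    (s≤s ())
oneMinusX-degree (suc (suc i)) _ = refl

convo-beyond-degree : ∀ {f d} → DegreeAtMost f d → ∀ a n i → convo f a n (i + d) ≡ convo f a n d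
convo-beyond-degree             f-deg a n zero    = refl
convo-beyond-degree {f} {d} f-deg a n (suc i) =
  trans (cong₂ ℤ._+_ (trans (cong (ℤ._* a (n ∸ suc (i + d))) (f-deg (suc (i + d)) (s≤s (m≤n+m d i))))
                            (*-zeroˡ (a (n ∸ suc (i + d)))))
                     (convo-beyond-degree f-deg a n i))
        (+-identityˡ (convo f a n d))

Δ³ : Series → ℕ → ℤ
Δ³ a j = a (3 + j) - ℤ.+ 3 ℤ.* a (2 + j) ℤ.+ ℤ.+ 3 ℤ.* a (1 + j) - a j

cube-⊛ : ∀ a j → ((oneMinusX ^ˢ 3) ⊛ a) (3 + j) ≡ Δ³ a j
cube-⊛ a j = begin
  convo cube a (3 + j) (3 + j)  ≡⟨ cong (convo cube a (3 + j)) (+-comm 3 j) ⟩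
  convo cube a (3 + j) (j + 3)  ≡⟨ convo-beyond-degree (^ˢ-degree oneMinusX-degree 3) a (3 + j) j ⟩
  convo cube a (3 + j) 3        ≡⟨ expand (a j) (a (1 + j)) (a (2 + j)) (a (3 + j)) ⟩
  Δ³ a j                        ∎
  where
  open ≡-Reasoning
  cube : Series
  cube = oneMinusX ^ˢ 3
  expand : ∀ w x y z → -[1+ 0 ] ℤ.* w ℤ.+ (ℤ.+ 3 ℤ.* x ℤ.+ (-[1+ 2 ] ℤ.* y ℤ.+ ℤ.+ 1 ℤ.* z))
                     ≡ z - ℤ.+ 3 ℤ.* y ℤ.+ ℤ.+ 3 ℤ.* x - w
  expand = solve-∀

Δ³-cong : ∀ {a b : Series} → (∀ i → a i ≡ b i) → ∀ j → Δ³ a j ≡ Δ³ b j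
Δ³-cong a≗b j rewrite a≗b j | a≗b (1 + j) | a≗b (2 + j) | a≗b (3 + j) = refl

Δ³-binomial : ∀ c j → Δ³ (λ i → ℤ.+ (c + i C 2)) j ≡ 0ℤ
Δ³-binomial c j rewrite C2-suc (2 + j) | C2-suc (1 + j) | C2-suc j = ring (ℤ.+ c) (ℤ.+ j) (ℤ.+ (j C 2))
  where
  -- ℤ.+ (m + n) computes to ℤ.+ m ℤ.+ ℤ.+ n, so the goal is an instance of ring.
  ring : ∀ c J X → (c ℤ.+ (ℤ.+ 2 ℤ.+ J ℤ.+ (ℤ.+ 1 ℤ.+ J ℤ.+ (J ℤ.+ X))))
                   - ℤ.+ 3 ℤ.* (c ℤ.+ (ℤ.+ 1 ℤ.+ J ℤ.+ (J ℤ.+ X)))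
                   ℤ.+ ℤ.+ 3 ℤ.* (c ℤ.+ (J ℤ.+ X)) - (c ℤ.+ X) ≡ 0ℤ
  ring = solve-∀

C2-formula : ∀ n → n C 2 ≡ (n * (n ∸ 1)) / 2
C2-formula zero          = refl
C2-formula (suc zero)    = refl
C2-formula (suc (suc m)) =
  trans (nCk≡nPk/k! {2} {suc (suc m)} (s≤s (s≤s z≤n)))
        (cong (_/ 2) (trans (cong (suc m *_) (*-identityʳ (suc (suc m)))) (*-comm (suc m) (suc (suc m)))))

length-Cat011-gf :
  HasGF (λ n → length (Cat n p011)) (poly (ℤ.+ 1 ∷ ℤ.- (ℤ.+ 2) ∷ ℤ.+ 2 ∷ [])) (oneMinusX ^ˢ 3)
length-Cat011-gf 0 = refl
length-Cat011-gf 1 = refl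
length-Cat011-gf 2 = refl
length-Cat011-gf (suc (suc (suc j))) =
  trans (cube-⊛ _ j) (trans (Δ³-cong (cong ℤ.+_ ∘ length-Cat011) j) (Δ³-binomial 1 j))

des-Cat011-gf :
  HasGF (λ n → sum (map des (Cat n p011))) (poly (0ℤ ∷ 0ℤ ∷ 0ℤ ∷ ℤ.+ 1 ∷ [])) (oneMinusX ^ˢ 3)
des-Cat011-gf 0 = refl
des-Cat011-gf 1 = refl
des-Cat011-gf 2 = refl
des-Cat011-gf 3 = refl
des-Cat011-gf (suc (suc (suc (suc j)))) =
  trans (cube-⊛ _ (suc j))
        (trans (Δ³-cong {a = λ i → ℤ.+ sum (map des (Cat (suc i) p011))} (cong ℤ.+_ ∘ des-Cat011) j)
               (Δ³-binomial 0 j))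

corollary7 :
    HasGF (λ n → length (Cat n (0 ∷ 1 ∷ 1 ∷ [])))
          (poly (ℤ.+ 1 ∷ ℤ.- (ℤ.+ 2) ∷ ℤ.+ 2 ∷ []))
          (oneMinusX ^ˢ 3)
    × (∀ (n : ℕ) → length (Cat n (0 ∷ 1 ∷ 1 ∷ [])) ≡ 1 + (n C 2))
    × (∀ (n : ℕ) → sum (map des (Cat (suc n) (0 ∷ 1 ∷ 1 ∷ [])))
                     ≡ ((suc n ∸ 1) * (suc n ∸ 2)) / 2)
    × HasGF (λ n → sum (map des (Cat n (0 ∷ 1 ∷ 1 ∷ []))))
            (poly (ℤ.0ℤ ∷ ℤ.0ℤ ∷ ℤ.0ℤ ∷ ℤ.+ 1 ∷ []))
            (oneMinusX ^ˢ 3)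
corollary7 =
  length-Cat011-gf , length-Cat011 , (λ n → trans (des-Cat011 n) (C2-formula n)) , des-Cat011-gf
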